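{- Let $n\ge0$. For a sparse subset $F\subseteq[n-1]$ let $\gamma_F$ be the unique pseudocomposition of $n$ with $J(\gamma_F)=[0,n-1]\setminus(F\cup(F-1))$. Then: (i) $\gamma_F$ is almost-odd and $\#F=\frac{n-k(\gamma_F)}{2}$; (ii) $F\mapsto\gamma_F$ is a bijection between sparse subsets of $[n-1]$ and almost-odd compositions of $n$; (iii) for a sparse $G\subseteq[n-1]$ and a pseudocomposition $\beta$ of $n$ with $J=J(\beta)$: $G\subseteq[n-1]\setminus(J\cup(J+1))$ if and only if $\beta\le\gamma_G$; (iv) for sparse $F,G\subseteq[n-1]$: $F\preceq G\iff G\cup(G-1)\subseteq F\cup(F-1)\iff\gamma_F\le\gamma_G$.
   Context: $[m,n]=\{m,\dots,n\}$, $[n]=[1,n]$, $J+i=\{x+i:x\in J\}$. A set of integers is sparse if it contains no two consecutive integers. A pseudocomposition of $n$ is $\beta=(b_0,b_1,\dots,b_k)$, integers with $b_0\ge0$, $b_i\ge1$ ($i\ge1$), sum $n$; its number of parts is $k(\beta)=k$; $J(\beta)=\{b_0,b_0+b_1,\dots,b_0+\dots+b_{k-1}\}\subseteq[0,n-1]$ (this is a bijection between pseudocompositions of $n$ and subsets of $[0,n-1]$). $\beta\le\beta'$ (refinement) means $J(\beta)\subseteq J(\beta')$. $\beta$ is almost-odd if $b_0$ is even and $b_i$ is odd for all $i\ge1$. For sparse $F$, $\bar F=F\cup((F-1)\cap(F+1))$, and $F\preceq G$ means $\bar F\supseteq G$. -}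

module Defs where

open import Level using (0ℓ)
open import Data.Nat using (ℕ; zero; suc; _+_; _*_; _≤_; _<_)
open import Data.Nat.Divisibility using (_∣_)
open import Data.List using (List; []; _∷_; length)
open import Data.Nat.ListAction using (sum)
open import Data.List.Relation.Unary.All using (All)
open import Data.List.Membership.Propositional using () renaming (_∈_ to _∈ˡ_)
open import Data.Fin using (Fin; toℕ)
open import Data.Fin.Subset using (Subset) renaming (_∈_ to _∈ˢ_)
open import Data.Product using (Σ; _×_; ∃-syntax)
open import Data.Empty using (⊥)
open import Relation.Nullary using (¬_)
open import Relation.Binary.PropositionalEquality using (_≡_)
open import Relation.Unary using (Pred; _∪_; _∩_; ∁; _⊆_; _≐_)

minus1 : Pred ℕ 0ℓ → Pred ℕ 0ℓ
minus1 P x = P (suc x)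

plus1 : Pred ℕ 0ℓ → Pred ℕ 0ℓ
plus1 P x = ∃[ y ] (x ≡ suc y × P y)

range0 : ℕ → Pred ℕ 0ℓ
range0 n x = x < n

range1 : ℕ → Pred ℕ 0ℓ
range1 n x = 1 ≤ x × x < n

-- Finite subsets of [0, n-1] are represented by  Subset n  (Data.Fin.Subset),
-- element i : Fin n standing for the natural number toℕ i.
-- Its cardinality is  Data.Fin.Subset.∣_∣ .

⟦_⟧ : {n : ℕ} → Subset n → Pred ℕ 0ℓ
⟦_⟧ {n} F x = Σ (Fin n) λ i → toℕ i ≡ x × i ∈ˢ F

SparseSub : {n : ℕ} → Subset n → Set
SparseSub F = ¬ (⟦ F ⟧ 0) × (∀ x → ⟦ F ⟧ x → ⟦ F ⟧ (suc x) → ⊥)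

record PC (n : ℕ) : Set where
  constructor pc
  field
    b0    : ℕ
    parts : List ℕ
    pos   : All (λ b → 1 ≤ b) parts
    total : b0 + sum parts ≡ n
open PC public

k : {n : ℕ} → PC n → ℕ
k β = length (parts β)

partialSums : ℕ → List ℕ → List ℕ
partialSums s []       = []
partialSums s (b ∷ bs) = s ∷ partialSums (s + b) bs

J : {n : ℕ} → PC n → Pred ℕ 0ℓ
J β x = x ∈ˡ partialSums (b0 β) (parts β)

_≤ᴾ_ : {n : ℕ} → PC n → PC n → Set
β ≤ᴾ β' = J β ⊆ J β'

Even Odd : ℕ → Set
Even m = 2 ∣ m
Odd m = ¬ Even m

AlmostOdd : {n : ℕ} → PC n → Set
AlmostOdd β = Even (b0 β) × All Odd (parts β)

IsGamma : {n : ℕ} → Subset n → PC n → Set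
IsGamma {n} F γ = J γ ≐ (range0 n ∩ ∁ (⟦ F ⟧ ∪ minus1 ⟦ F ⟧))

bar : {n : ℕ} → Subset n → Pred ℕ 0ℓ
bar F = ⟦ F ⟧ ∪ (minus1 ⟦ F ⟧ ∩ plus1 ⟦ F ⟧)

_⪯_ : {n : ℕ} → Subset n → Subset n → Set
F ⪯ G = ⟦ G ⟧ ⊆ bar F

{-# OPTIONS --safe #-}
-- A sparse F ⊆ [n-1] is a tiling of [0, n-1] by monominoes and dominoes, the dominoes
-- being {f-1, f} for f ∈ F.  Then F ∪ (F-1) is the set of cells covered by dominoes, so
-- J(γ_F) is the set of positions of monominoes: b₀ is the length of the initial run of
-- dominoes and every further part is a monomino followed by a run of dominoes.  Hence γ_F
-- is almost-odd with 2 #F + k(γ_F) = n, and conversely an almost-odd pseudocomposition is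
-- read off exactly one tiling.  Since β ↦ J(β) is injective, γ_F is unique, and (iii) and
-- (iv) only concern the sets J(β) and F ∪ (F-1).
module Submission where

open import Level using (0ℓ)
open import Data.Nat using (ℕ; zero; suc; _+_; _*_; _≤_; _<_; z≤n; s≤s)
open import Data.Nat.Properties
open import Data.Nat.Divisibility using (_∣_; _∣0; ∣-refl; ∣1⇒≡1; ∣m∣n⇒∣m+n; ∣m+n∣m⇒∣n)
open import Data.Nat.ListAction using (sum)
open import Data.List using (List; []; _∷_; length)
open import Data.List.Properties using (∷-injectiveˡ; ∷-injectiveʳ)
open import Data.List.Relation.Unary.All as All using (All; []; _∷_)
open import Data.List.Relation.Unary.Any using (here; there)
open import Data.List.Membership.Propositional using (_∈_; _∉_)
open import Data.Bool using (Bool; true; false)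
open import Data.Fin using () renaming (zero to fzero; suc to fsuc)
open import Data.Fin.Properties using (toℕ<n)
open import Data.Fin.Subset using (Subset; ∣_∣)
open import Data.Vec using ([]; _∷_; here; there)
open import Data.Product using (Σ; _×_; _,_; proj₁; proj₂; ∃-syntax)
open import Data.Sum using (inj₁; inj₂; [_,_])
import Data.Sum as Sum
open import Data.Empty using (⊥; ⊥-elim)
open import Function using (_∘_)
open import Relation.Nullary using (¬_; Dec; yes; no)
open import Relation.Binary.PropositionalEquality using (_≡_; refl; sym; trans; cong; cong₂; subst)
open import Relation.Unary using (Pred; _∪_; _∩_; ∁; _⊆_)
open import Function.Bundles using (_⇔_; mk⇔)

open import Defs

variable
  n m s x : ℕ
  b : Bool
  v : Subset n

⟦[]⟧-empty : ¬ ⟦ [] ⟧ x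
⟦[]⟧-empty (() , _)

0∈⟦true∷⟧ : ⟦ true ∷ v ⟧ 0
0∈⟦true∷⟧ = fzero , refl , here

0∉⟦false∷⟧ : ¬ ⟦ false ∷ v ⟧ 0
0∉⟦false∷⟧ (fzero , refl , ())
0∉⟦false∷⟧ (fsuc _ , () , _)

⟦∷⟧-suc⁺ : ⟦ v ⟧ x → ⟦ b ∷ v ⟧ (suc x)
⟦∷⟧-suc⁺ (i , refl , i∈v) = fsuc i , refl , there i∈v

⟦∷⟧-suc⁻ : ⟦ b ∷ v ⟧ (suc x) → ⟦ v ⟧ x
⟦∷⟧-suc⁻ (fsuc i , refl , there i∈v) = i , refl , i∈v

⟦⟧-dec : (F : Subset n) (x : ℕ) → Dec (⟦ F ⟧ x)
⟦⟧-dec [] x = no ⟦[]⟧-empty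
⟦⟧-dec (true ∷ F) zero = yes 0∈⟦true∷⟧
⟦⟧-dec (false ∷ F) zero = no 0∉⟦false∷⟧
⟦⟧-dec (b ∷ F) (suc x) with ⟦⟧-dec F x
... | yes x∈F = yes (⟦∷⟧-suc⁺ x∈F)
... | no x∉F = no (x∉F ∘ ⟦∷⟧-suc⁻)

⟦⟧⊆range0 : {F : Subset n} → ⟦ F ⟧ ⊆ range0 n
⟦⟧⊆range0 (i , refl , _) = toℕ<n i

covered : Subset n → Pred ℕ 0ℓ
covered F = ⟦ F ⟧ ∪ minus1 ⟦ F ⟧

covered⊆range0 : {F : Subset n} → covered F ⊆ range0 n
covered⊆range0 (inj₁ x∈F) = ⟦⟧⊆range0 x∈F
covered⊆range0 (inj₂ x+1∈F) = <-trans (n<1+n _) (⟦⟧⊆range0 x+1∈F)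

covered-suc⁺ : covered v x → covered (b ∷ v) (suc x)
covered-suc⁺ = Sum.map ⟦∷⟧-suc⁺ ⟦∷⟧-suc⁺

covered-suc⁻ : covered (b ∷ v) (suc x) → covered v x
covered-suc⁻ = Sum.map ⟦∷⟧-suc⁻ ⟦∷⟧-suc⁻

NoConsecutive : Subset n → Set
NoConsecutive F = ∀ x → ⟦ F ⟧ x → ⟦ F ⟧ (suc x) → ⊥

noConsecutive-tail : NoConsecutive (b ∷ v) → NoConsecutive v
noConsecutive-tail nc x x∈F x+1∈F = nc (suc x) (⟦∷⟧-suc⁺ x∈F) (⟦∷⟧-suc⁺ x+1∈F)

sparse-false∷⁺ : NoConsecutive v → SparseSub (false ∷ v)
sparse-false∷⁺ nc = 0∉⟦false∷⟧ , λ
  { zero 0∈F _ → 0∉⟦false∷⟧ 0∈F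
  ; (suc x) x∈F x+1∈F → nc x (⟦∷⟧-suc⁻ x∈F) (⟦∷⟧-suc⁻ x+1∈F) }

sparse-false∷⁻ : SparseSub (false ∷ v) → NoConsecutive v
sparse-false∷⁻ = noConsecutive-tail ∘ proj₂

sparse-false∷true∷⁺ : SparseSub v → SparseSub (false ∷ true ∷ v)
sparse-false∷true∷⁺ (0∉F , nc) = sparse-false∷⁺ λ
  { zero _ 1∈F → 0∉F (⟦∷⟧-suc⁻ 1∈F)
  ; (suc x) x∈F x+1∈F → nc x (⟦∷⟧-suc⁻ x∈F) (⟦∷⟧-suc⁻ x+1∈F) }

sparse-false∷true∷⁻ : SparseSub (false ∷ true ∷ v) → SparseSub v
sparse-false∷true∷⁻ (_ , nc) =
  (λ 0∈F → nc 1 (⟦∷⟧-suc⁺ 0∈⟦true∷⟧) (⟦∷⟧-suc⁺ (⟦∷⟧-suc⁺ 0∈F))) ,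
  noConsecutive-tail (noConsecutive-tail nc)

sparse⇒positive : {F : Subset n} → SparseSub F → ⟦ F ⟧ x → 1 ≤ x
sparse⇒positive {x = zero} (0∉F , _) 0∈F = ⊥-elim (0∉F 0∈F)
sparse⇒positive {x = suc x} _ _ = s≤s z≤n

Even-2+ : Even m → Even (2 + m)
Even-2+ = ∣m∣n⇒∣m+n ∣-refl

Even-2+⁻ : Even (2 + m) → Even m
Even-2+⁻ e = ∣m+n∣m⇒∣n e ∣-refl

Even⇒Odd-suc : Even m → Odd (suc m)
Even⇒Odd-suc {m} e e′ with ∣1⇒≡1 (∣m+n∣m⇒∣n (subst (2 ∣_) (+-comm 1 m) e′) e)
... | ()

Odd-suc⇒Even : Odd (suc m) → Even m
Odd-suc⇒Even {zero} _ = 2 ∣0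
Odd-suc⇒Even {suc zero} o = ⊥-elim (o ∣-refl)
Odd-suc⇒Even {suc (suc m)} o = Even-2+ (Odd-suc⇒Even (o ∘ Even-2+))

partialSums-suc⁺ : ∀ ps → x ∈ partialSums s ps → suc x ∈ partialSums (suc s) ps
partialSums-suc⁺ (_ ∷ ps) (here refl) = here refl
partialSums-suc⁺ (_ ∷ ps) (there m) = there (partialSums-suc⁺ ps m)

partialSums-suc⁻ : ∀ ps → suc x ∈ partialSums (suc s) ps → x ∈ partialSums s ps
partialSums-suc⁻ (_ ∷ ps) (here refl) = here refl
partialSums-suc⁻ (_ ∷ ps) (there m) = there (partialSums-suc⁻ ps m)

0∉partialSums-suc : ∀ ps → 0 ∉ partialSums (suc s) ps
0∉partialSums-suc (_ ∷ ps) (there m) = 0∉partialSums-suc ps m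

partialSums-≥ : ∀ ps → x ∈ partialSums s ps → s ≤ x
partialSums-≥ (_ ∷ ps) (here refl) = ≤-refl
partialSums-≥ {s = s} (b ∷ ps) (there m) = ≤-trans (m≤m+n s b) (partialSums-≥ ps m)

partialSums-< : ∀ ps → All (1 ≤_) ps → x ∈ partialSums s ps → x < s + sum ps
partialSums-< {s = s} (b ∷ ps) (1≤b ∷ _) (here refl) = m<m+n s (≤-trans 1≤b (m≤m+n b (sum ps)))
partialSums-< {x = x} {s = s} (b ∷ ps) (_ ∷ pos) (there m) =
  subst (x <_) (+-assoc s b (sum ps)) (partialSums-< ps pos m)

partialSums-there⁻ : ∀ {b} ps → x ∈ partialSums s (b ∷ ps) → s < x → x ∈ partialSums (s + b) ps
partialSums-there⁻ ps (here refl) s<s = ⊥-elim (<-irrefl refl s<s)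
partialSums-there⁻ ps (there m) _ = m

-- The totals are needed only to tell apart two pseudocompositions with no parts.
partialSums-injective : ∀ s ps s′ ps′ → All (1 ≤_) ps → All (1 ≤_) ps′ →
  s + sum ps ≡ s′ + sum ps′ →
  (∀ {x} → x ∈ partialSums s ps → x ∈ partialSums s′ ps′) →
  (∀ {x} → x ∈ partialSums s′ ps′ → x ∈ partialSums s ps) →
  s ≡ s′ × ps ≡ ps′
partialSums-injective s [] s′ [] _ _ total _ _ = +-cancelʳ-≡ 0 s s′ total , refl
partialSums-injective s (b ∷ ps) s′ [] _ _ _ ⊆′ _ with () ← ⊆′ (here refl)
partialSums-injective s [] s′ (b′ ∷ ps′) _ _ _ _ ⊇′ with () ← ⊇′ (here refl)
partialSums-injective s (b ∷ ps) s′ (b′ ∷ ps′) (1≤b ∷ pos) (1≤b′ ∷ pos′) total ⊆′ ⊇′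
  with refl ← ≤-antisym (partialSums-≥ (b ∷ ps) (⊇′ (here refl)))
                        (partialSums-≥ (b′ ∷ ps′) (⊆′ (here refl)))
  with run , tails ← partialSums-injective (s + b) ps (s + b′) ps′ pos pos′
         (trans (+-assoc s b (sum ps)) (trans total (sym (+-assoc s b′ (sum ps′)))))
         (λ m → partialSums-there⁻ ps′ (⊆′ (there m)) (<-≤-trans (m<m+n s 1≤b) (partialSums-≥ ps m)))
         (λ m → partialSums-there⁻ ps (⊇′ (there m)) (<-≤-trans (m<m+n s 1≤b′) (partialSums-≥ ps′ m)))
  = refl , cong₂ _∷_ (+-cancelˡ-≡ s b b′ run) tails

PC-ext : {β β′ : PC n} → b0 β ≡ b0 β′ → parts β ≡ parts β′ → β ≡ β′
PC-ext {β = pc _ _ pos total} {pc _ _ pos′ total′} refl refl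
  with refl ← All.irrelevant ≤-irrelevant pos pos′ | refl ← ≡-irrelevant total total′
  = refl

J-injective : {β β′ : PC n} → J β ⊆ J β′ → J β′ ⊆ J β → β ≡ β′
J-injective {β = β} {β′} ⊆′ ⊇′ =
  let run , tails = partialSums-injective (b0 β) (parts β) (b0 β′) (parts β′) (pos β) (pos β′)
                      (trans (total β) (sym (total β′))) ⊆′ ⊇′
  in PC-ext run tails

J⊆range0 : (β : PC n) → J β ⊆ range0 n
J⊆range0 β x∈J = subst (_ <_) (total β) (partialSums-< (parts β) (pos β) x∈J)

isGamma-unique : {F : Subset n} {γ γ′ : PC n} → IsGamma F γ → IsGamma F γ′ → γ ≡ γ′
isGamma-unique (γ⊆ , ⊆γ) (γ′⊆ , ⊆γ′) = J-injective (⊆γ′ ∘ γ⊆) (⊆γ ∘ γ′⊆)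

data Tiling : ℕ → Set where
  []     : Tiling 0
  mono   : Tiling n → Tiling (suc n)
  domino : Tiling n → Tiling (suc (suc n))

dominoEnds : Tiling n → Subset n
dominoEnds [] = []
dominoEnds (mono T) = false ∷ dominoEnds T
dominoEnds (domino T) = false ∷ true ∷ dominoEnds T

leadingRun : Tiling n → ℕ
leadingRun [] = 0
leadingRun (mono T) = 0
leadingRun (domino T) = 2 + leadingRun T

tilingParts : Tiling n → List ℕ
tilingParts [] = []
tilingParts (mono T) = suc (leadingRun T) ∷ tilingParts T
tilingParts (domino T) = tilingParts T

tilingParts-positive : (T : Tiling n) → All (1 ≤_) (tilingParts T)
tilingParts-positive [] = []
tilingParts-positive (mono T) = s≤s z≤n ∷ tilingParts-positive T
tilingParts-positive (domino T) = tilingParts-positive T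

tiling-total : (T : Tiling n) → leadingRun T + sum (tilingParts T) ≡ n
tiling-total [] = refl
tiling-total (mono T) = cong suc (tiling-total T)
tiling-total (domino T) = cong (2 +_) (tiling-total T)

γᵀ : Tiling n → PC n
γᵀ T = pc (leadingRun T) (tilingParts T) (tilingParts-positive T) (tiling-total T)

dominoEnds-sparse : (T : Tiling n) → SparseSub (dominoEnds T)
dominoEnds-sparse [] = ⟦[]⟧-empty , λ _ x∈F _ → ⟦[]⟧-empty x∈F
dominoEnds-sparse (mono T) = sparse-false∷⁺ (proj₂ (dominoEnds-sparse T))
dominoEnds-sparse (domino T) = sparse-false∷true∷⁺ (dominoEnds-sparse T)

dominoEnds-count : (T : Tiling n) → 2 * ∣ dominoEnds T ∣ + length (tilingParts T) ≡ n
dominoEnds-count [] = refl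
dominoEnds-count (mono T) = trans (+-suc _ _) (cong suc (dominoEnds-count T))
dominoEnds-count (domino T) =
  trans (cong (_+ length (tilingParts T)) (*-suc 2 ∣ dominoEnds T ∣)) (cong (2 +_) (dominoEnds-count T))

γᵀ-almostOdd : (T : Tiling n) → AlmostOdd (γᵀ T)
γᵀ-almostOdd [] = 2 ∣0 , []
γᵀ-almostOdd (mono T) = 2 ∣0 , Even⇒Odd-suc (proj₁ (γᵀ-almostOdd T)) ∷ proj₂ (γᵀ-almostOdd T)
γᵀ-almostOdd (domino T) = Even-2+ (proj₁ (γᵀ-almostOdd T)) , proj₂ (γᵀ-almostOdd T)

sparse⇒tiling : (F : Subset n) → SparseSub F → Σ (Tiling n) λ T → dominoEnds T ≡ F
sparse⇒tiling [] _ = [] , refl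
sparse⇒tiling (true ∷ F) (0∉F , _) = ⊥-elim (0∉F 0∈⟦true∷⟧)
sparse⇒tiling (false ∷ []) _ = mono [] , refl
sparse⇒tiling (false ∷ false ∷ F) sp
  with T , e ← sparse⇒tiling (false ∷ F) (sparse-false∷⁺ (noConsecutive-tail (sparse-false∷⁻ sp)))
  = mono T , cong (false ∷_) e
sparse⇒tiling (false ∷ true ∷ F) sp
  with T , e ← sparse⇒tiling F (sparse-false∷true∷⁻ sp)
  = domino T , cong (λ F′ → false ∷ true ∷ F′) e

tiling-injective : (T T′ : Tiling n) →
  leadingRun T ≡ leadingRun T′ → tilingParts T ≡ tilingParts T′ → T ≡ T′
tiling-injective [] [] _ _ = refl
tiling-injective (mono T) (mono T′) _ e =
  cong mono (tiling-injective T T′ (suc-injective (∷-injectiveˡ e)) (∷-injectiveʳ e))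
tiling-injective (domino T) (domino T′) r e =
  cong domino (tiling-injective T T′ (suc-injective (suc-injective r)) e)
tiling-injective (mono _) (domino _) () _
tiling-injective (domino _) (mono _) () _

tiling-fromParts : ∀ b₀ ps → Even b₀ → All Odd ps →
  Σ (Tiling (b₀ + sum ps)) λ T → leadingRun T ≡ b₀ × tilingParts T ≡ ps
tiling-fromParts zero [] _ [] = [] , refl , refl
tiling-fromParts zero (zero ∷ ps) _ (o ∷ _) = ⊥-elim (o (2 ∣0))
tiling-fromParts zero (suc p ∷ ps) _ (o ∷ os)
  with T , r , e ← tiling-fromParts p ps (Odd-suc⇒Even o) os
  = mono T , refl , cong₂ _∷_ (cong suc r) e
tiling-fromParts (suc zero) ps ev _ = ⊥-elim (Even⇒Odd-suc (2 ∣0) ev)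
tiling-fromParts (suc (suc b₀)) ps ev os
  with T , r , e ← tiling-fromParts b₀ ps (Even-2+⁻ ev) os
  = domino T , cong (2 +_) r , e

J-γᵀ⁺ : (T : Tiling n) → J (γᵀ T) x → x < n × ¬ covered (dominoEnds T) x
J-γᵀ⁺ {x = zero} (mono T) _ = s≤s z≤n , [ 0∉⟦false∷⟧ , proj₁ (dominoEnds-sparse T) ∘ ⟦∷⟧-suc⁻ ]
J-γᵀ⁺ {x = suc x} (mono T) (there m) =
  let x<n , x∉ = J-γᵀ⁺ T (partialSums-suc⁻ (tilingParts T) m) in s≤s x<n , x∉ ∘ covered-suc⁻
J-γᵀ⁺ {x = zero} (domino T) m = ⊥-elim (0∉partialSums-suc (tilingParts T) m)
J-γᵀ⁺ {x = suc zero} (domino T) m =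
  ⊥-elim (0∉partialSums-suc (tilingParts T) (partialSums-suc⁻ (tilingParts T) m))
J-γᵀ⁺ {x = suc (suc x)} (domino T) m =
  let x<n , x∉ = J-γᵀ⁺ T (partialSums-suc⁻ (tilingParts T) (partialSums-suc⁻ (tilingParts T) m))
  in s≤s (s≤s x<n) , x∉ ∘ covered-suc⁻ ∘ covered-suc⁻

J-γᵀ⁻ : (T : Tiling n) → x < n → ¬ covered (dominoEnds T) x → J (γᵀ T) x
J-γᵀ⁻ {x = zero} (mono T) _ _ = here refl
J-γᵀ⁻ {x = suc x} (mono T) (s≤s x<n) x∉ =
  there (partialSums-suc⁺ (tilingParts T) (J-γᵀ⁻ T x<n (x∉ ∘ covered-suc⁺)))
J-γᵀ⁻ {x = zero} (domino T) _ 0∉ = ⊥-elim (0∉ (inj₂ (⟦∷⟧-suc⁺ 0∈⟦true∷⟧)))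
J-γᵀ⁻ {x = suc zero} (domino T) _ 1∉ = ⊥-elim (1∉ (inj₁ (⟦∷⟧-suc⁺ 0∈⟦true∷⟧)))
J-γᵀ⁻ {x = suc (suc x)} (domino T) (s≤s (s≤s x<n)) x∉ =
  partialSums-suc⁺ (tilingParts T) (partialSums-suc⁺ (tilingParts T)
    (J-γᵀ⁻ T x<n (x∉ ∘ covered-suc⁺ ∘ covered-suc⁺)))

isGamma-γᵀ : (T : Tiling n) → IsGamma (dominoEnds T) (γᵀ T)
isGamma-γᵀ T = J-γᵀ⁺ T , λ (x<n , x∉) → J-γᵀ⁻ T x<n x∉

almostOdd⇒tiling : (β : PC n) → AlmostOdd β → Σ (Tiling n) λ T → γᵀ T ≡ β
almostOdd⇒tiling (pc b₀ ps _ refl) (ev , os) =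
  let T , run , tails = tiling-fromParts b₀ ps ev os in T , PC-ext run tails

γ-exists-unique : (F : Subset n) → SparseSub F →
  ∃[ γ ] (IsGamma F γ × ((γ′ : PC n) → IsGamma F γ′ → γ′ ≡ γ))
γ-exists-unique F sp with T , refl ← sparse⇒tiling F sp =
  γᵀ T , isGamma-γᵀ T , λ _ isγ′ → isGamma-unique isγ′ (isGamma-γᵀ T)

γ-almostOdd-count : (F : Subset n) → SparseSub F → (γ : PC n) → IsGamma F γ →
  AlmostOdd γ × 2 * ∣ F ∣ + k γ ≡ n
γ-almostOdd-count F sp γ isγ
  with T , refl ← sparse⇒tiling F sp
  with refl ← isGamma-unique {γ = γᵀ T} {γ} (isGamma-γᵀ T) isγ
  = γᵀ-almostOdd T , dominoEnds-count T

γ-surjective : (γ : PC n) → AlmostOdd γ → ∃[ F ] (SparseSub F × IsGamma F γ)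
γ-surjective γ ao with T , refl ← almostOdd⇒tiling γ ao =
  dominoEnds T , dominoEnds-sparse T , isGamma-γᵀ T

γ-injective : (F F′ : Subset n) → SparseSub F → SparseSub F′ → (γ : PC n) →
  IsGamma F γ → IsGamma F′ γ → F ≡ F′
γ-injective F F′ sp sp′ γ isγ isγ′
  with T , refl ← sparse⇒tiling F sp | T′ , refl ← sparse⇒tiling F′ sp′ =
  cong dominoEnds (tiling-injective T T′ (cong b0 γᵀT≡γᵀT′) (cong parts γᵀT≡γᵀT′))
  where
  γᵀT≡γᵀT′ : γᵀ T ≡ γᵀ T′
  γᵀT≡γᵀT′ = trans (isGamma-unique {γ′ = γ} (isGamma-γᵀ T) isγ) (isGamma-unique isγ′ (isGamma-γᵀ T′))

⊆∁[J∪J+1]⇔≤ᴾγ : (G : Subset n) → SparseSub G → (γG : PC n) → IsGamma G γG → (β : PC n) →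
  (⟦ G ⟧ ⊆ (range1 n ∩ ∁ (J β ∪ plus1 (J β)))) ⇔ (β ≤ᴾ γG)
⊆∁[J∪J+1]⇔≤ᴾγ {n} G sp γG (γG⊆ , ⊆γG) β = mk⇔ to from
  where
  to : ⟦ G ⟧ ⊆ (range1 n ∩ ∁ (J β ∪ plus1 (J β))) → β ≤ᴾ γG
  to G⊆ {x} x∈J = ⊆γG (J⊆range0 β x∈J ,
    [ (λ x∈G → proj₂ (G⊆ x∈G) (inj₁ x∈J))
    , (λ x+1∈G → proj₂ (G⊆ x+1∈G) (inj₂ (x , refl , x∈J))) ])

  from : β ≤ᴾ γG → ⟦ G ⟧ ⊆ (range1 n ∩ ∁ (J β ∪ plus1 (J β)))
  from β≤γG x∈G = (sparse⇒positive sp x∈G , ⟦⟧⊆range0 x∈G) ,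
    [ (λ x∈J → proj₂ (γG⊆ (β≤γG x∈J)) (inj₁ x∈G))
    , (λ { (_ , refl , y∈J) → proj₂ (γG⊆ (β≤γG y∈J)) (inj₂ x∈G) }) ]

⪯⇔covered⊇ : (F G : Subset n) → SparseSub G → (F ⪯ G) ⇔ (covered G ⊆ covered F)
⪯⇔covered⊇ F G (0∉G , _) = mk⇔ to from
  where
  to : F ⪯ G → covered G ⊆ covered F
  to F⪯G (inj₁ x∈G) with F⪯G x∈G
  ... | inj₁ x∈F = inj₁ x∈F
  ... | inj₂ (x+1∈F , _) = inj₂ x+1∈F
  to F⪯G (inj₂ x+1∈G) with F⪯G x+1∈G
  ... | inj₁ x+1∈F = inj₂ x+1∈F
  ... | inj₂ (_ , _ , refl , x∈F) = inj₁ x∈F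

  from : covered G ⊆ covered F → F ⪯ G
  from ⊆′ {zero} 0∈G = ⊥-elim (0∉G 0∈G)
  from ⊆′ {suc y} y+1∈G with ⊆′ {suc y} (inj₁ y+1∈G) | ⊆′ {y} (inj₂ y+1∈G)
  ... | inj₁ y+1∈F | _ = inj₁ y+1∈F
  ... | inj₂ y+2∈F | inj₁ y∈F = inj₂ (y+2∈F , y , refl , y∈F)
  ... | inj₂ _ | inj₂ y+1∈F = inj₁ y+1∈F

covered⊇⇔γ≤ᴾγ : (F G : Subset n) (γF γG : PC n) → IsGamma F γF → IsGamma G γG →
  (covered G ⊆ covered F) ⇔ (γF ≤ᴾ γG)
covered⊇⇔γ≤ᴾγ F G γF γG (γF⊆ , ⊆γF) (γG⊆ , ⊆γG) = mk⇔ to from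
  where
  to : covered G ⊆ covered F → γF ≤ᴾ γG
  to ⊆′ x∈γF = let x<n , x∉F = γF⊆ x∈γF in ⊆γG (x<n , x∉F ∘ ⊆′)

  from : γF ≤ᴾ γG → covered G ⊆ covered F
  from γF≤γG {x} x∈G with ⟦⟧-dec F x | ⟦⟧-dec F (suc x)
  ... | yes x∈F | _ = inj₁ x∈F
  ... | no _ | yes x+1∈F = inj₂ x+1∈F
  ... | no x∉F | no x+1∉F =
    ⊥-elim (proj₂ (γG⊆ (γF≤γG (⊆γF (covered⊆range0 x∈G , [ x∉F , x+1∉F ])))) x∈G)

lemma2p2 : (n : ℕ) →
  -- γ_F is well defined: for sparse F ⊆ [n-1] there is a unique such pseudocomposition
  ((F : Subset n) → SparseSub F →
      ∃[ γ ] (IsGamma F γ × ((γ' : PC n) → IsGamma F γ' → γ' ≡ γ)))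
  -- (i)
  × ((F : Subset n) → SparseSub F → (γ : PC n) → IsGamma F γ →
      AlmostOdd γ × 2 * ∣ F ∣ + k γ ≡ n)
  -- (ii) F ↦ γ_F is a bijection onto almost-odd pseudocompositions
  --      (lands in almost-odd ones by (i); surjective; injective)
  × ((γ : PC n) → AlmostOdd γ → ∃[ F ] (SparseSub F × IsGamma F γ))
  × ((F F' : Subset n) → SparseSub F → SparseSub F' → (γ : PC n) →
      IsGamma F γ → IsGamma F' γ → F ≡ F')
  -- (iii)
  × ((G : Subset n) → SparseSub G → (γG : PC n) → IsGamma G γG → (β : PC n) →
      ((⟦ G ⟧ ⊆ (range1 n ∩ ∁ (J β ∪ plus1 (J β))))
        ⇔ (β ≤ᴾ γG)))
  -- (iv)
  × ((F G : Subset n) → SparseSub F → SparseSub G →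
      (γF γG : PC n) → IsGamma F γF → IsGamma G γG →
      ((F ⪯ G) ⇔ ((⟦ G ⟧ ∪ minus1 ⟦ G ⟧) ⊆ (⟦ F ⟧ ∪ minus1 ⟦ F ⟧)))
      × (((⟦ G ⟧ ∪ minus1 ⟦ G ⟧) ⊆ (⟦ F ⟧ ∪ minus1 ⟦ F ⟧)) ⇔ (γF ≤ᴾ γG)))
lemma2p2 n =
  γ-exists-unique , γ-almostOdd-count , γ-surjective , γ-injective , ⊆∁[J∪J+1]⇔≤ᴾγ ,
  λ F G _ spG γF γG isγF isγG → ⪯⇔covered⊇ F G spG , covered⊇⇔γ≤ᴾγ F G γF γG isγF isγG
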